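{- Let $E$ be a set of positive integers. Suppose there exists a family $\mathcal{F}$ of finite sets of positive integers satisfying: (1) for every $k\in\mathbb{N}$ there exists $\ell\in\mathbb{N}$ such that for all $F\in\mathcal{F}$ of cardinality at least $\ell$, the set $\{n\in\mathbb{N}: |(n+F)\cap E|\ge k\}$ is infinite; (2) for every $\ell\in\mathbb{N}$ there exists $C\in\mathbb{N}$ such that for every family $I_1,\dots,I_\ell$ of intervals of length at least $C$, there exists $F=\{f_1,\dots,f_\ell\}\in\mathcal{F}$ with $f_j\in I_j$ for all $j\in[\ell]$. Then every thick set is chromatically $E$-intersective.
   Context: $\mathbb{N}=\{1,2,\dots\}$, $[\ell]=\{1,\dots,\ell\}$. $T\subset\mathbb{N}$ is thick if it contains arbitrarily long intervals of consecutive integers. A set $R\subset\mathbb{N}$ is chromatically $E$-intersective if for every finite partition $E=\bigcup_{i=1}^rE_i$ there exists $i$ with $R\cap(E_i-E_i)\neq\varnothing$, where $E_i-E_i=\{a-b:a,b\in E_i\}$. -}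

module Defs where

open import Data.Nat using (ℕ; zero; suc; _+_; _∸_; _≤_; _<_)
open import Data.Fin using (Fin)
open import Data.List using (List; length)
open import Data.List.Relation.Unary.All using (All)
open import Data.List.Relation.Unary.Linked using (Linked)
open import Data.List.Membership.Propositional using (_∈_)
open import Data.List.Relation.Binary.Sublist.Propositional using (_⊆_)
open import Data.Product using (Σ; ∃; ∃-syntax; _×_; _,_; proj₁)
open import Function.Bundles using (_⇔_)
open import Relation.Binary.PropositionalEquality using (_≡_)
open import Level using (0ℓ)

Pred : Set₁
Pred = ℕ → Set

PositiveSet : Pred → Set
PositiveSet A = ∀ n → A n → 1 ≤ n

record FinSet : Set where
  constructor finset
  field
    elems    : List ℕ
    strict   : Linked _<_ elems
    positive : All (1 ≤_) elems
open FinSet public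

∣_∣ : FinSet → ℕ
∣ F ∣ = length (elems F)

_∈F_ : ℕ → FinSet → Set
x ∈F F = x ∈ elems F

-- |(n + F) ∩ E| ≥ k : there are at least k (distinct) elements f of F with n + f ∈ E
AtLeastInShift : Pred → ℕ → FinSet → ℕ → Set
AtLeastInShift E n F k =
  Σ (List ℕ) λ G → (G ⊆ elems F) × (k ≤ length G) × All (λ f → E (n + f)) G

InfiniteSet : Pred → Set
InfiniteSet A = ∀ m → ∃[ n ] (m < n × A n)

record Interval : Set where
  constructor interval
  field
    start    : ℕ
    len      : ℕ
    startPos : 1 ≤ start
open Interval public

_∈I_ : ℕ → Interval → Set
x ∈I I = start I ≤ x × x < start I + len I

Condition1 : Pred → (FinSet → Set) → Set
Condition1 E 𝓕 =
  ∀ (k : ℕ) → ∃[ ℓ ] ∀ (F : FinSet) → 𝓕 F → ℓ ≤ ∣ F ∣ →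
    InfiniteSet (λ n → AtLeastInShift E n F k)

Condition2 : (FinSet → Set) → Set
Condition2 𝓕 =
  ∀ (ℓ : ℕ) → ∃[ C ] ∀ (I : Fin ℓ → Interval) → (∀ j → C ≤ len (I j)) →
    Σ FinSet λ F → (𝓕 F × Σ (Fin ℓ → ℕ) λ f → ((∀ (j : Fin ℓ) → f j ∈I I j)
                          × (∀ x → (x ∈F F) ⇔ (Σ (Fin ℓ) λ j → f j ≡ x))))

Thick : Pred → Set
Thick T = ∀ (L : ℕ) → ∃[ a ] (1 ≤ a × (∀ i → i < L → T (a + i)))

-- Chromatically E-intersective: for every finite partition E = E₁ ∪ … ∪ E_r
-- (given by a colouring χ : ℕ → Fin r, restricted to E) some cell E_i
-- has R ∩ (E_i - E_i) ≠ ∅ (elements of R are positive, so a > b).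
ChromaticallyIntersective : Pred → Pred → Set
ChromaticallyIntersective E R =
  ∀ (r : ℕ) (χ : ℕ → Fin r) →
    ∃[ a ] ∃[ b ] (b < a × E a × E b × χ a ≡ χ b × R (a ∸ b))

-- Cut ℕ into blocks of length C separated by gaps, the gap after block j
-- being the start of a run of T long enough to contain every difference
-- between an element of block j+1 and an element of an earlier block.
-- Condition (2) gives F ∈ 𝓕 meeting each of the first ℓ blocks, so every
-- positive difference of elements of F lies in T, and ℓ ≤ |F|.  Taking
-- ℓ from condition (1) with k = r + 1 yields a shift n + F with r + 1
-- elements in E; two of them receive the same colour, and their
-- difference is a difference of F.
module Submission where

open import Defs
open import Data.Nat using (ℕ; zero; suc; _+_; _∸_; _≤_; _<_; z≤n; s≤s)
open import Data.Nat.Properties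
open import Data.Fin as Fin using (Fin; toℕ)
import Data.Fin.Properties as FinP
open import Data.List using (List; length; lookup)
import Data.List.Relation.Unary.All as All
open import Data.List.Relation.Unary.AllPairs using (AllPairs; []; _∷_)
open import Data.List.Relation.Unary.Linked.Properties using (Linked⇒AllPairs)
open import Data.List.Membership.Propositional using (_∈_)
open import Data.List.Membership.Propositional.Properties using (∈-lookup)
open import Data.List.Membership.Setoid.Properties using (index-injective)
open import Data.List.Relation.Binary.Sublist.Propositional using (_⊇_; []; _∷_; _∷ʳ_)
open import Data.List.Relation.Binary.Sublist.Propositional.Properties using (All-resp-⊆; Any-resp-⊆)
open import Data.Product using (Σ; ∃-syntax; ∃₂; _×_; _,_; proj₁; proj₂)
open import Data.Sum using (inj₁; inj₂)
open import Function using (_∘_)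
open import Function.Bundles using (Equivalence)
open import Function.Definitions using (Injective)
open import Relation.Binary.Core using (Rel)
open import Relation.Binary.Definitions using (_Respects_; tri<; tri≈; tri>)
open import Relation.Binary.PropositionalEquality
open import Relation.Nullary using (contradiction)

module _ {a r} {A : Set a} {R : Rel A r} where

  AllPairs-resp-⊆ : AllPairs R Respects _⊇_
  AllPairs-resp-⊆ []         []         = []
  AllPairs-resp-⊆ (_ ∷ʳ τ)   (_ ∷ pxs)  = AllPairs-resp-⊆ τ pxs
  AllPairs-resp-⊆ (refl ∷ τ) (px ∷ pxs) = All-resp-⊆ τ px ∷ AllPairs-resp-⊆ τ pxs

  AllPairs-lookup : ∀ {xs} → AllPairs R xs → ∀ {i j} → i Fin.< j →
                    R (lookup xs i) (lookup xs j)
  AllPairs-lookup (px ∷ _)   {Fin.zero}  {Fin.suc j} _          = All.lookup px (∈-lookup j)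
  AllPairs-lookup (_  ∷ pxs) {Fin.suc i} {Fin.suc j} (s≤s i<j) = AllPairs-lookup pxs i<j

  monochromaticPair : ∀ {xs n} → AllPairs R xs → n < length xs → (c : A → Fin n) →
                      ∃₂ λ x y → x ∈ xs × y ∈ xs × R x y × c x ≡ c y
  monochromaticPair {xs} pairs n<∣xs∣ c =
    let i , j , i<j , same = FinP.pigeonhole n<∣xs∣ (c ∘ lookup xs)
    in lookup xs i , lookup xs j , ∈-lookup i , ∈-lookup j , AllPairs-lookup pairs i<j , same

injective⇒≤-length : ∀ {a} {A : Set a} {n} {xs : List A} {f : Fin n → A} →
                     Injective _≡_ _≡_ f → (∀ i → f i ∈ xs) → n ≤ length xs
injective⇒≤-length {A = A} f-inj f∈xs =
  FinP.injective⇒≤ λ {i} {j} → f-inj ∘ index-injective (setoid A) (f∈xs i) (f∈xs j)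

run-contains : ∀ {T : Pred} {a L m} → (∀ i → i < L → T (a + i)) →
               a ≤ m → m < a + L → T m
run-contains {T} {a} {L} {m} run a≤m m<a+L =
  subst T a+[m∸a]≡m (run (m ∸ a) (+-cancelˡ-< a (m ∸ a) L (subst (_< a + L) (sym a+[m∸a]≡m) m<a+L)))
  where
  a+[m∸a]≡m : a + (m ∸ a) ≡ m
  a+[m∸a]≡m = m+[n∸m]≡n a≤m

module Blocks {T : Pred} (thick : Thick T) (C : ℕ) where

  gap : ℕ → ℕ
  gap b = proj₁ (thick (b + C + C))

  blockStart : ℕ → ℕ
  blockStart zero    = 1
  blockStart (suc j) = blockStart j + C + gap (blockStart j)

  block : ℕ → Interval
  block j = interval (blockStart j) C (blockStart-positive j)
    where
    blockStart-positive : ∀ j → 1 ≤ blockStart j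
    blockStart-positive zero    = ≤-refl
    blockStart-positive (suc j) = ≤-trans (blockStart-positive j) (≤-trans (m≤m+n _ C) (m≤m+n _ _))

  InBlock : ℕ → ℕ → Set
  InBlock j x = x ∈I block j

  blockStart-step : ∀ j → blockStart j + C ≤ blockStart (suc j)
  blockStart-step j = m≤m+n _ _

  blockStart-mono : ∀ {i j} → i ≤ j → blockStart i ≤ blockStart j
  blockStart-mono {j = zero}  z≤n = ≤-refl
  blockStart-mono {j = suc j} i≤1+j with m≤n⇒m<n∨m≡n i≤1+j
  ... | inj₁ (s≤s i≤j) = ≤-trans (blockStart-mono i≤j) (≤-trans (m≤m+n _ C) (blockStart-step j))
  ... | inj₂ refl      = ≤-refl

  blocks-separated : ∀ {i j} → i < j → blockStart i + C ≤ blockStart j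
  blocks-separated {j = suc j} (s≤s i≤j) =
    ≤-trans (+-monoˡ-≤ C (blockStart-mono i≤j)) (blockStart-step j)

  -- With b = blockStart j and g = gap b, the difference lies in [g, g + b + 2C),
  -- which is the run of T starting at g.
  gap-differences : ∀ {j x y} → x < blockStart j + C → InBlock (suc j) y → T (y ∸ x)
  gap-differences {j} {x} {y} x<b+C (b+C+g≤y , y<b+C+g+C) =
    run-contains {T} (proj₂ (proj₂ (thick (b + C + C)))) g≤y∸x y∸x<g+b+C+C
    where
    open ≤-Reasoning
    b = blockStart j
    g = gap b
    g≤y∸x : g ≤ y ∸ x
    g≤y∸x = m+n≤o⇒m≤o∸n g (begin
      g + x       ≤⟨ +-monoʳ-≤ g (<⇒≤ x<b+C) ⟩
      g + (b + C) ≡⟨ +-comm g (b + C) ⟩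
      b + C + g   ≤⟨ b+C+g≤y ⟩
      y           ∎)
    y∸x<g+b+C+C : y ∸ x < g + (b + C + C)
    y∸x<g+b+C+C = begin-strict
      y ∸ x           ≤⟨ m∸n≤m y x ⟩
      y               <⟨ y<b+C+g+C ⟩
      b + C + g + C   ≡⟨ cong (_+ C) (+-comm (b + C) g) ⟩
      g + (b + C) + C ≡⟨ +-assoc g (b + C) C ⟩
      g + (b + C + C) ∎

  block-differences : ∀ {i j x y} → i < j → InBlock i x → InBlock j y → T (y ∸ x)
  block-differences {i} {suc j} (s≤s i≤j) (_ , x<bᵢ+C) =
    gap-differences {j} (<-≤-trans x<bᵢ+C (+-monoˡ-≤ C (blockStart-mono i≤j)))

  module Transversal {ℓ} (f : Fin ℓ → ℕ) (f∈block : ∀ j → InBlock (toℕ j) (f j)) where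

    increasing : ∀ {i j} → i Fin.< j → f i < f j
    increasing {i} {j} i<j =
      <-≤-trans (proj₂ (f∈block i)) (≤-trans (blocks-separated i<j) (proj₁ (f∈block j)))

    injective : Injective _≡_ _≡_ f
    injective {i} {j} fi≡fj with FinP.<-cmp i j
    ... | tri< i<j _ _ = contradiction fi≡fj (<⇒≢ (increasing i<j))
    ... | tri≈ _ i≡j _ = i≡j
    ... | tri> _ _ j<i = contradiction (sym fi≡fj) (<⇒≢ (increasing j<i))

    image-differences : ∀ {x y} → Σ (Fin ℓ) (λ i → f i ≡ x) → Σ (Fin ℓ) (λ j → f j ≡ y) →
                        x < y → T (y ∸ x)
    image-differences (i , refl) (j , refl) fi<fj with FinP.<-cmp i j
    ... | tri< i<j _ _ = block-differences i<j (f∈block i) (f∈block j)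
    ... | tri≈ _ refl _ = contradiction fi<fj (<-irrefl refl)
    ... | tri> _ _ j<i = contradiction (increasing j<i) (<-asym fi<fj)

DifferencesIn : Pred → FinSet → Set
DifferencesIn T F = ∀ {x y} → x ∈F F → y ∈F F → x < y → T (y ∸ x)

thick⇒large-member : ∀ {T 𝓕} → Thick T → Condition2 𝓕 →
                     ∀ ℓ → Σ FinSet λ F → 𝓕 F × ℓ ≤ ∣ F ∣ × DifferencesIn T F
thick⇒large-member {T} thick cond2 ℓ =
  let C , transversals = cond2 ℓ
      open Blocks {T} thick C
      F , F∈𝓕 , f , f∈block , F≡imf = transversals (block ∘ toℕ) (λ _ → ≤-refl)
      open Transversal f f∈block
      open Equivalence
  in F , F∈𝓕 ,
     injective⇒≤-length injective (λ j → from (F≡imf (f j)) (j , refl)) ,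
     λ x∈F y∈F → image-differences (to (F≡imf _) x∈F) (to (F≡imf _) y∈F)

monochromaticDifference : ∀ {E T : Pred} {F n r} → DifferencesIn T F →
                          AtLeastInShift E n F (suc r) → (χ : ℕ → Fin r) →
                          ∃[ a ] ∃[ b ] (b < a × E a × E b × χ a ≡ χ b × T (a ∸ b))
monochromaticDifference {T = T} {F} {n} differences (G , G⊆F , r<∣G∣ , n+G⊆E) χ =
  let G-increasing = AllPairs-resp-⊆ G⊆F (Linked⇒AllPairs <-trans (strict F))
      x , y , x∈G , y∈G , x<y , same = monochromaticPair G-increasing r<∣G∣ (χ ∘ (n +_))
  in n + y , n + x , +-monoʳ-< n x<y ,
     All.lookup n+G⊆E y∈G , All.lookup n+G⊆E x∈G , sym same ,
     subst T (sym ([m+n]∸[m+o]≡n∸o n y x))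
       (differences (Any-resp-⊆ G⊆F x∈G) (Any-resp-⊆ G⊆F y∈G) x<y)

proposition6p4 : (E : Pred) → PositiveSet E → (𝓕 : FinSet → Set) →
    Condition1 E 𝓕 → Condition2 𝓕 →
    (T : Pred) → PositiveSet T → Thick T → ChromaticallyIntersective E T
proposition6p4 E _ 𝓕 cond1 cond2 T _ thick r χ =
  let ℓ , largeShifts = cond1 (suc r)
      F , F∈𝓕 , ℓ≤∣F∣ , differences = thick⇒large-member {T} thick cond2 ℓ
      n , _ , r+1-in-E = largeShifts F F∈𝓕 ℓ≤∣F∣ 0
  in monochromaticDifference {E} {T} {F} differences r+1-in-E χ
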